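{- Let $p$ be a prime, $q$ a power of $p$, and $m \in \mathbb{F}_q\setminus\{0\}$. Then \[ \mathcal{O} F(p,m) = \Sigma F(p, m^{ -1}). \]
   Context: For $m\in\mathbb{F}_q$, $F(p,m) = (a_{i,j})_{0\le i,j\le p-1}$ is the $p\times p$ matrix over $\mathbb{F}_q$ with $a_{i,0} = a_{0,j} = 1$ and $a_{i,j} = a_{i-1,j} + m\,a_{i-1,j-1} + a_{i,j-1}$ for $i,j\ge1$. For $m \ne 0$, $\mathcal{O}F(p,m)$ is the matrix obtained from $F(p,m)$ by dividing row $i$ by $(-m)^i$ for each $i = 0,\dots,p-1$. For a matrix $A = (\vec a_1,\dots,\vec a_n)$ given by its columns, $\Sigma A = (\vec a_n,\dots,\vec a_1)$ (columns in reverse order). -}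

module Defs where

open import Level using (Level; 0ℓ)
open import Data.Nat using (ℕ; zero; suc)
open import Data.Fin using (Fin; toℕ; opposite)
open import Relation.Binary.PropositionalEquality using (_≡_)
open import Relation.Nullary using (¬_)
open import Algebra.Structures using (IsCommutativeRing)
open import Function.Bundles using (_↔_)

-- The inverse is a
-- total function; only its value on nonzero elements is constrained
-- (x⁻¹ is only ever applied to nonzero elements in the statement).
record Field : Set₁ where
  infixl 7 _*_
  infixl 6 _+_
  infix  8 -_
  infix  9 _⁻¹
  field
    Carrier : Set
    _+_ _*_ : Carrier → Carrier → Carrier
    -_      : Carrier → Carrier
    0# 1#   : Carrier
    _⁻¹     : Carrier → Carrier
    isCommutativeRing : IsCommutativeRing _≡_ _+_ _*_ -_ 0# 1#
    0≢1     : ¬ (0# ≡ 1#)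
    *-inverse : (x : Carrier) → ¬ (x ≡ 0#) → x * (x ⁻¹) ≡ 1#

  _^_ : Carrier → ℕ → Carrier
  x ^ zero  = 1#
  x ^ suc n = x * (x ^ n)

HasCard : Field → ℕ → Set
HasCard F q = Fin q ↔ Field.Carrier F

module _ (F : Field) where
  open Field F

  -- entries a_{i,j} of F(n,m) (for all n simultaneously):
  -- a_{i,0} = a_{0,j} = 1, a_{i,j} = a_{i-1,j} + m a_{i-1,j-1} + a_{i,j-1}
  Fentry : Carrier → ℕ → ℕ → Carrier
  Fentry m zero    j       = 1#
  Fentry m (suc i) zero    = 1#
  Fentry m (suc i) (suc j) = Fentry m i (suc j) + m * Fentry m i j + Fentry m (suc i) j

  Fmat : (n : ℕ) → Carrier → Fin n → Fin n → Carrier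
  Fmat n m i j = Fentry m (toℕ i) (toℕ j)

  𝒪 : (n : ℕ) → Carrier → (Fin n → Fin n → Carrier) → Fin n → Fin n → Carrier
  𝒪 n m A i j = A i j * (((- m) ^ toℕ i) ⁻¹)

  Σᶜ : (n : ℕ) → (Fin n → Fin n → Carrier) → Fin n → Fin n → Carrier
  Σᶜ n A i j = A i (opposite j)

{-# OPTIONS --safe #-}
-- Write Rᵢ(y) = Σⱼ aᵢⱼ(x) yʲ for row i of F(·, x). The recurrence reads
-- (1 − y) Rᵢ = (1 + x y) Rᵢ₋₁, so (1 − y)ⁱ⁺¹ Rᵢ = (1 + x y)ⁱ. In characteristic p the binomial
-- coefficients (p choose k), 0 < k < p, vanish, hence (1 − y)ᵖ ≡ 1 mod yᵖ and
-- Rᵢ ≡ (1 − y)ᵖ⁻¹⁻ⁱ (1 + x y)ⁱ mod yᵖ. Reading off the coefficient of yᵖ⁻¹ gives the last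
-- column aᵢ,ₚ₋₁(x) = (−1)ᵖ⁻¹⁻ⁱ xⁱ = (−x)ⁱ, where (−1)ᵖ⁻¹ = 1 is the case x = 1, i = 0.
-- For m m′ = 1 the identity aᵢⱼ(m) = (−m)ⁱ aᵢ,ₚ₋₁₋ⱼ(m′) then follows from the recurrence by
-- induction, the column j = 0 being the last column for m′. A field with pᵏ elements has
-- characteristic p because Σₓ x = Σₓ (x + 1) forces pᵏ · 1 = 0.
module Submission where

open import Defs
open import Level using (0ℓ)
open import Algebra.Bundles using (CommutativeRing)
open import Algebra.Core using (Op₁; Op₂)
open import Algebra.Structures using (IsCommutativeRing)
import Algebra.Properties.AbelianGroup as AbelianGroupProperties
import Algebra.Properties.CommutativeMonoid.Sum as CommutativeMonoidSum
import Algebra.Properties.CommutativeSemigroup as CommutativeSemigroupProperties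
import Algebra.Properties.CommutativeSemiring.Exp as CommutativeSemiringExp
import Algebra.Properties.Ring as RingProperties
import Algebra.Properties.Semiring.Exp as SemiringExp
import Algebra.Properties.Semiring.Mult as SemiringMult
import Algebra.Solver.Ring as RingSolver
open import Algebra.Solver.Ring.AlmostCommutativeRing using (AlmostCommutativeRing; _-Raw-AlmostCommutative⟶_; fromCommutativeRing)
open import Data.Fin as Fin using (Fin)
import Data.Fin.Properties as Fin
open import Data.Integer as ℤ using (ℤ; -[1+_])
import Data.Integer.Properties as ℤ
open import Data.Maybe using (Maybe; just; nothing)
open import Data.Nat as ℕ using (ℕ; zero; suc; _<_; _≤_; z≤n; s≤s)
import Data.Nat.Properties as ℕ
open import Data.Nat.Divisibility using (_∣_; divides; ∣⇒≤)
open import Data.Nat.Primality using (Prime; euclidsLemma)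
open import Data.Sign as Sign using (Sign)
open import Data.Sum using (inj₁; inj₂)
open import Function.Bundles using (_↔_; Inverse; mk↔ₛ′)
open import Function.Construct.Composition using (_↔-∘_)
open import Function.Construct.Symmetry using (↔-sym)
open import Relation.Binary.Definitions using (DecidableEquality)
open import Relation.Binary.PropositionalEquality
open import Relation.Nullary using (¬_; yes; no; contradiction)
open import Relation.Nullary.Decidable using (decidable-stable)

module Binomial where
  open import Data.Nat using (_+_; _*_)
  open import Data.Nat.Properties using (*-zeroʳ; *-comm; <⇒≱)
  open import Data.Nat.Tactic.RingSolver using (solve-∀)

  infixl 7 _choose_
  _choose_ : ℕ → ℕ → ℕ
  n     choose zero  = 1
  zero  choose suc k = 0
  suc n choose suc k = n choose k + n choose suc k

  suc-*-choose : ∀ n k → suc k * (suc n choose suc k) ≡ suc n * (n choose k)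
  suc-*-choose zero    zero    = refl
  suc-*-choose zero    (suc k) = *-zeroʳ (suc (suc k))
  suc-*-choose (suc n) zero    = cong suc (suc-*-choose n zero)
  suc-*-choose (suc n) (suc k) = begin
    suc (suc k) * (X + Y)
      ≡⟨ distrib (suc k) X Y ⟩
    suc k * X + X + suc (suc k) * Y
      ≡⟨ cong₂ (λ a b → a + X + b) (suc-*-choose n k) (suc-*-choose n (suc k)) ⟩
    suc n * (n choose k) + X + suc n * (n choose suc k)
      ≡⟨ collect (suc n) (n choose k) (n choose suc k) ⟩
    suc (suc n) * X ∎
    where
    open ≡-Reasoning
    X = suc n choose suc k
    Y = suc n choose suc (suc k)
    distrib : ∀ k X Y → suc k * (X + Y) ≡ k * X + X + suc k * Y
    distrib = solve-∀
    collect : ∀ m a b → m * a + (a + b) + m * b ≡ suc m * (a + b)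
    collect = solve-∀

  prime∣choose : ∀ {p k} → Prime p → suc k < p → p ∣ p choose suc k
  prime∣choose {suc n} {k} p-prime k<p with euclidsLemma (suc k) (suc n choose suc k) p-prime p∣product
    where
    p∣product : suc n ∣ suc k * (suc n choose suc k)
    p∣product = divides (n choose k) (trans (suc-*-choose n k) (*-comm (suc n) (n choose k)))
  ... | inj₁ p∣suc-k  = contradiction (∣⇒≤ p∣suc-k) (<⇒≱ k<p)
  ... | inj₂ p∣choose = p∣choose

open Binomial using (_choose_; prime∣choose)

module CommutativeRingArithmetic
  {A : Set} {add mul : Op₂ A} {neg : Op₁ A} {0ᴿ 1ᴿ : A}
  (isCommutativeRing : IsCommutativeRing _≡_ add mul neg 0ᴿ 1ᴿ) where

  commutativeRing : CommutativeRing 0ℓ 0ℓ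
  commutativeRing = record { isCommutativeRing = isCommutativeRing }

  open CommutativeRing commutativeRing
    using ( _+_; _*_; -_; 0#; 1#; _-_; +-identityˡ; +-identityʳ; *-identityˡ; zeroʳ; -‿inverseʳ
          ; ring; semiring; commutativeSemiring; +-commutativeSemigroup; *-commutativeSemigroup; +-abelianGroup)
  open RingProperties ring using (-1*x≈-x; -0#≈0#; -‿involutive)
  open AbelianGroupProperties +-abelianGroup using (⁻¹-∙-comm)
  open SemiringMult semiring using (_×_; ×-homo-+; ×1-homo-*)
  open SemiringExp semiring using (_^_)
  open CommutativeSemiringExp commutativeSemiring using (^-distrib-*)
  open ≡-Reasoning

  fromℕ : ℕ → A
  fromℕ n = n × 1#

  fromℕ-^ : ∀ m n → fromℕ (m ℕ.^ n) ≡ fromℕ m ^ n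
  fromℕ-^ m zero    = +-identityʳ 1#
  fromℕ-^ m (suc n) = trans (×1-homo-* m (m ℕ.^ n)) (cong (fromℕ m *_) (fromℕ-^ m n))

  1^n≡1 : ∀ n → 1# ^ n ≡ 1#
  1^n≡1 zero    = refl
  1^n≡1 (suc n) = trans (*-identityˡ _) (1^n≡1 n)

  [-1]^n*[-1]^n≡1 : ∀ n → (- 1#) ^ n * (- 1#) ^ n ≡ 1#
  [-1]^n*[-1]^n≡1 n = begin
    (- 1#) ^ n * (- 1#) ^ n  ≡⟨ ^-distrib-* (- 1#) (- 1#) n ⟨
    (- 1# * - 1#) ^ n        ≡⟨ cong (_^ n) (trans (-1*x≈-x (- 1#)) (-‿involutive 1#)) ⟩
    1# ^ n                   ≡⟨ 1^n≡1 n ⟩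
    1#                       ∎

  fromSign : Sign → A
  fromSign Sign.+ = 1#
  fromSign Sign.- = - 1#

  fromℤ : ℤ → A
  fromℤ (ℤ.+ n)    = fromℕ n
  fromℤ -[1+ n ] = - fromℕ (suc n)

  fromSign-* : ∀ s t → fromSign (s Sign.* t) ≡ fromSign s * fromSign t
  fromSign-* Sign.+ t      = sym (*-identityˡ _)
  fromSign-* Sign.- Sign.+ = sym (-1*x≈-x _)
  fromSign-* Sign.- Sign.- = sym (trans (-1*x≈-x _) (-‿involutive 1#))

  fromℤ-◃ : ∀ s n → fromℤ (s ℤ.◃ n) ≡ fromSign s * fromℕ n
  fromℤ-◃ s       zero    = sym (zeroʳ _)
  fromℤ-◃ Sign.+ (suc n) = sym (*-identityˡ _)
  fromℤ-◃ Sign.- (suc n) = sym (-1*x≈-x _)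

  fromℤ-signAbs : ∀ i → fromℤ i ≡ fromSign (ℤ.sign i) * fromℕ ℤ.∣ i ∣
  fromℤ-signAbs i = trans (cong fromℤ (sym (ℤ.◃-inverse i))) (fromℤ-◃ (ℤ.sign i) ℤ.∣ i ∣)

  fromℤ-⊖ : ∀ m n → fromℤ (m ℤ.⊖ n) ≡ fromℕ m - fromℕ n
  fromℤ-⊖ m       zero    = sym (trans (cong (fromℕ m +_) -0#≈0#) (+-identityʳ _))
  fromℤ-⊖ zero    (suc n) = sym (+-identityˡ _)
  fromℤ-⊖ (suc m) (suc n) = begin
    fromℤ (suc m ℤ.⊖ suc n)              ≡⟨ cong fromℤ (ℤ.[1+m]⊖[1+n]≡m⊖n m n) ⟩
    fromℤ (m ℤ.⊖ n)                      ≡⟨ fromℤ-⊖ m n ⟩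
    fromℕ m - fromℕ n                    ≡⟨ +-identityˡ _ ⟨
    0# + (fromℕ m - fromℕ n)             ≡⟨ cong (_+ (fromℕ m - fromℕ n)) (-‿inverseʳ 1#) ⟨
    (1# - 1#) + (fromℕ m - fromℕ n)      ≡⟨ interchange 1# (- 1#) (fromℕ m) (- fromℕ n) ⟩
    (1# + fromℕ m) + (- 1# - fromℕ n)    ≡⟨ cong ((1# + fromℕ m) +_) (⁻¹-∙-comm 1# (fromℕ n)) ⟩
    fromℕ (suc m) - fromℕ (suc n)        ∎
    where open CommutativeSemigroupProperties +-commutativeSemigroup using (interchange)

  fromℤ-homo-- : ∀ i → fromℤ (ℤ.- i) ≡ - fromℤ i
  fromℤ-homo-- (ℤ.+ zero)  = sym -0#≈0#
  fromℤ-homo-- (ℤ.+ suc n) = refl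
  fromℤ-homo-- -[1+ n ]  = sym (-‿involutive _)

  fromℤ-homo-+ : ∀ i j → fromℤ (i ℤ.+ j) ≡ fromℤ i + fromℤ j
  fromℤ-homo-+ -[1+ m ] -[1+ n ] = begin
    - fromℕ (suc (suc (m ℕ.+ n)))         ≡⟨ cong (λ k → - fromℕ k) (ℕ.+-suc (suc m) n) ⟨
    - fromℕ (suc m ℕ.+ suc n)             ≡⟨ cong -_ (×-homo-+ 1# (suc m) (suc n)) ⟩
    - (fromℕ (suc m) + fromℕ (suc n))     ≡⟨ ⁻¹-∙-comm _ _ ⟨
    - fromℕ (suc m) - fromℕ (suc n)       ∎
  fromℤ-homo-+ -[1+ m ] (ℤ.+ n)    = trans (fromℤ-⊖ n (suc m)) (+-comm _ _)
    where open CommutativeRing commutativeRing using (+-comm)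
  fromℤ-homo-+ (ℤ.+ m)    -[1+ n ] = fromℤ-⊖ m (suc n)
  fromℤ-homo-+ (ℤ.+ m)    (ℤ.+ n)    = ×-homo-+ 1# m n

  fromℤ-homo-* : ∀ i j → fromℤ (i ℤ.* j) ≡ fromℤ i * fromℤ j
  fromℤ-homo-* i j = begin
    fromℤ (i ℤ.* j)
      ≡⟨ fromℤ-◃ (ℤ.sign i Sign.* ℤ.sign j) (ℤ.∣ i ∣ ℕ.* ℤ.∣ j ∣) ⟩
    fromSign (ℤ.sign i Sign.* ℤ.sign j) * fromℕ (ℤ.∣ i ∣ ℕ.* ℤ.∣ j ∣)
      ≡⟨ cong₂ _*_ (fromSign-* (ℤ.sign i) (ℤ.sign j)) (×1-homo-* ℤ.∣ i ∣ ℤ.∣ j ∣) ⟩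
    (fromSign (ℤ.sign i) * fromSign (ℤ.sign j)) * (fromℕ ℤ.∣ i ∣ * fromℕ ℤ.∣ j ∣)
      ≡⟨ interchange _ _ _ _ ⟩
    (fromSign (ℤ.sign i) * fromℕ ℤ.∣ i ∣) * (fromSign (ℤ.sign j) * fromℕ ℤ.∣ j ∣)
      ≡⟨ cong₂ _*_ (fromℤ-signAbs i) (fromℤ-signAbs j) ⟨
    fromℤ i * fromℤ j                                        ∎
    where open CommutativeSemigroupProperties *-commutativeSemigroup using (interchange)

  almostCommutativeRing : AlmostCommutativeRing 0ℓ 0ℓ
  almostCommutativeRing = fromCommutativeRing commutativeRing

  fromℤ-morphism : ℤ.+-*-rawRing -Raw-AlmostCommutative⟶ almostCommutativeRing
  fromℤ-morphism = record
    { ⟦_⟧    = fromℤ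
    ; +-homo = fromℤ-homo-+
    ; *-homo = fromℤ-homo-*
    ; -‿homo = fromℤ-homo--
    ; 0-homo = refl
    ; 1-homo = +-identityʳ 1#
    }

  fromℤ-≟ : ∀ i j → Maybe (fromℤ i ≡ fromℤ j)
  fromℤ-≟ i j with i ℤ.≟ j
  ... | yes refl = just refl
  ... | no _     = nothing

  -- With ℤ as coefficient ring the solver's normal forms compute, so its side condition is refl.
  open RingSolver ℤ.+-*-rawRing almostCommutativeRing fromℤ-morphism fromℤ-≟ public
    using (solve; _:=_; _:+_; _:*_; :-_; _:-_)

module DifferenceCalculus
  {A : Set} {add mul : Op₂ A} {neg : Op₁ A} {0ᴿ 1ᴿ : A}
  (isCommutativeRing : IsCommutativeRing _≡_ add mul neg 0ᴿ 1ᴿ) where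

  open CommutativeRingArithmetic isCommutativeRing
  open CommutativeRing commutativeRing
    using (_+_; _*_; -_; 0#; 1#; _-_; +-identityˡ; +-identityʳ; *-identityˡ; *-assoc; zeroˡ; zeroʳ; -‿inverseʳ; ring; semiring)
  open RingProperties ring using (-1*x≈-x; -0#≈0#)
  open SemiringExp semiring using (_^_)
  open SemiringMult semiring using (×-homo-+; ×1-homo-*)
  open ≡-Reasoning

  Seq : Set
  Seq = ℕ → A

  -- On generating functions Σⱼ f j yʲ, Δ multiplies by 1 − y, Λ x by 1 + x y, and
  -- (c ⋆ f) j = Σ_{k ≤ j} c k * f (j ∸ k) is the product.
  Δ : Seq → Seq
  Δ f zero    = f zero
  Δ f (suc j) = f (suc j) - f j

  Λ : A → Seq → Seq
  Λ x f zero    = f zero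
  Λ x f (suc j) = f (suc j) + x * f j

  Δ^ : ℕ → Seq → Seq
  Δ^ zero    f = f
  Δ^ (suc n) f = Δ (Δ^ n f)

  Λ^ : A → ℕ → Seq → Seq
  Λ^ x zero    f = f
  Λ^ x (suc n) f = Λ x (Λ^ x n f)

  δ : Seq
  δ zero    = 1#
  δ (suc _) = 0#

  Δ-cong : ∀ {f g} → (∀ j → f j ≡ g j) → ∀ j → Δ f j ≡ Δ g j
  Δ-cong f≗g zero    = f≗g zero
  Δ-cong f≗g (suc j) = cong₂ _-_ (f≗g (suc j)) (f≗g j)

  Λ-cong : ∀ {x f g} → (∀ j → f j ≡ g j) → ∀ j → Λ x f j ≡ Λ x g j
  Λ-cong f≗g zero        = f≗g zero
  Λ-cong {x} f≗g (suc j) = cong₂ (λ a b → a + x * b) (f≗g (suc j)) (f≗g j)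

  Δ^-cong : ∀ n {f g} → (∀ j → f j ≡ g j) → ∀ j → Δ^ n f j ≡ Δ^ n g j
  Δ^-cong zero    f≗g = f≗g
  Δ^-cong (suc n) f≗g = Δ-cong (Δ^-cong n f≗g)

  Δ^-+ : ∀ a b f → Δ^ (a ℕ.+ b) f ≡ Δ^ a (Δ^ b f)
  Δ^-+ zero    b f = refl
  Δ^-+ (suc a) b f = cong Δ (Δ^-+ a b f)

  Δ^-suc : ∀ n f j → Δ^ (suc n) f j ≡ Δ^ n (Δ f) j
  Δ^-suc zero    f j = refl
  Δ^-suc (suc n) f j = Δ-cong (Δ^-suc n f) j

  Δ∘Λ : ∀ x f j → Δ (Λ x f) j ≡ Λ x (Δ f) j
  Δ∘Λ x f zero          = refl
  Δ∘Λ x f (suc zero)    = solve 3 (λ a b x → (a :+ x :* b) :- b := (a :- b) :+ x :* b) refl (f 1) (f 0) x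
  Δ∘Λ x f (suc (suc j)) =
    solve 4 (λ a b c x → (a :+ x :* b) :- (b :+ x :* c) := (a :- b) :+ x :* (b :- c)) refl
      (f (suc (suc j))) (f (suc j)) (f j) x

  Δ^∘Λ : ∀ n x f j → Δ^ n (Λ x f) j ≡ Λ x (Δ^ n f) j
  Δ^∘Λ zero    x f j = refl
  Δ^∘Λ (suc n) x f j = trans (Δ-cong (Δ^∘Λ n x f) j) (Δ∘Λ x (Δ^ n f) j)

  VanishesAbove : ℕ → Seq → Set
  VanishesAbove d f = ∀ j → d < j → f j ≡ 0#

  δ-vanishes : VanishesAbove 0 δ
  δ-vanishes (suc j) _ = refl

  Δ-vanishes : ∀ {d f} → VanishesAbove d f → VanishesAbove (suc d) (Δ f)
  Δ-vanishes {f = f} f↑ (suc j) (s≤s d<j) = begin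
    f (suc j) - f j   ≡⟨ cong₂ _-_ (f↑ (suc j) (ℕ.m<n⇒m<1+n d<j)) (f↑ j d<j) ⟩
    0# - 0#           ≡⟨ -‿inverseʳ 0# ⟩
    0#                ∎

  Δ-top : ∀ {d f} → VanishesAbove d f → Δ f (suc d) ≡ - f d
  Δ-top {d} f↑ = trans (cong (_- _) (f↑ (suc d) (ℕ.n<1+n d))) (+-identityˡ _)

  Λ-vanishes : ∀ {x d f} → VanishesAbove d f → VanishesAbove (suc d) (Λ x f)
  Λ-vanishes {x} {f = f} f↑ (suc j) (s≤s d<j) = begin
    f (suc j) + x * f j   ≡⟨ cong₂ (λ a b → a + x * b) (f↑ (suc j) (ℕ.m<n⇒m<1+n d<j)) (f↑ j d<j) ⟩
    0# + x * 0#           ≡⟨ +-identityˡ _ ⟩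
    x * 0#                ≡⟨ zeroʳ x ⟩
    0#                    ∎

  Λ-top : ∀ {x d f} → VanishesAbove d f → Λ x f (suc d) ≡ x * f d
  Λ-top {d = d} f↑ = trans (cong (_+ _) (f↑ (suc d) (ℕ.n<1+n d))) (+-identityˡ _)

  Λ^δ-vanishes : ∀ x i → VanishesAbove i (Λ^ x i δ)
  Λ^δ-vanishes x zero    = δ-vanishes
  Λ^δ-vanishes x (suc i) = Λ-vanishes (Λ^δ-vanishes x i)

  Λ^δ-top : ∀ x i → Λ^ x i δ i ≡ x ^ i
  Λ^δ-top x zero    = refl
  Λ^δ-top x (suc i) = trans (Λ-top (Λ^δ-vanishes x i)) (cong (x *_) (Λ^δ-top x i))

  Δ^-vanishes : ∀ n {d g} → VanishesAbove d g → VanishesAbove (n ℕ.+ d) (Δ^ n g)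
  Δ^-vanishes zero    g↑ = g↑
  Δ^-vanishes (suc n) g↑ = Δ-vanishes (Δ^-vanishes n g↑)

  Δ^-top : ∀ n {d g} → VanishesAbove d g → Δ^ n g (n ℕ.+ d) ≡ (- 1#) ^ n * g d
  Δ^-top zero    {d} {g} g↑ = sym (*-identityˡ (g d))
  Δ^-top (suc n) {d} {g} g↑ = begin
    Δ (Δ^ n g) (suc (n ℕ.+ d))     ≡⟨ Δ-top (Δ^-vanishes n g↑) ⟩
    - Δ^ n g (n ℕ.+ d)             ≡⟨ cong -_ (Δ^-top n g↑) ⟩
    - ((- 1#) ^ n * g d)           ≡⟨ -1*x≈-x _ ⟨
    - 1# * ((- 1#) ^ n * g d)      ≡⟨ *-assoc _ _ _ ⟨
    (- 1#) ^ suc n * g d           ∎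

  infixl 7 _⋆_
  _⋆_ : Seq → Seq → Seq
  (c ⋆ f) zero    = c 0 * f 0
  (c ⋆ f) (suc j) = c 0 * f (suc j) + ((λ k → c (suc k)) ⋆ f) j

  ⋆-congˡ : ∀ {c c′} f → (∀ k → c k ≡ c′ k) → ∀ j → (c ⋆ f) j ≡ (c′ ⋆ f) j
  ⋆-congˡ f c≗c′ zero    = cong (_* f 0) (c≗c′ 0)
  ⋆-congˡ f c≗c′ (suc j) = cong₂ (λ a b → a * f (suc j) + b) (c≗c′ 0) (⋆-congˡ f (λ k → c≗c′ (suc k)) j)

  ⋆-distribʳ-- : ∀ a b f j → ((λ k → a k - b k) ⋆ f) j ≡ (a ⋆ f) j - (b ⋆ f) j
  ⋆-distribʳ-- a b f zero    = solve 3 (λ a b x → (a :- b) :* x := a :* x :- b :* x) refl _ _ _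
  ⋆-distribʳ-- a b f (suc j) = begin
    (a 0 - b 0) * f (suc j) + ((λ k → a (suc k) - b (suc k)) ⋆ f) j
      ≡⟨ cong ((a 0 - b 0) * f (suc j) +_) (⋆-distribʳ-- (λ k → a (suc k)) (λ k → b (suc k)) f j) ⟩
    (a 0 - b 0) * f (suc j) + (((λ k → a (suc k)) ⋆ f) j - ((λ k → b (suc k)) ⋆ f) j)
      ≡⟨ solve 5 (λ a b x u v → (a :- b) :* x :+ (u :- v) := (a :* x :+ u) :- (b :* x :+ v)) refl _ _ _ _ _ ⟩
    (a ⋆ f) (suc j) - (b ⋆ f) (suc j) ∎

  Δ-⋆ : ∀ c f j → Δ (c ⋆ f) j ≡ (Δ c ⋆ f) j
  Δ-⋆ c f zero    = refl
  Δ-⋆ c f (suc j) = sym (begin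
    c 0 * f (suc j) + ((λ k → c (suc k) - c k) ⋆ f) j
      ≡⟨ cong (c 0 * f (suc j) +_) (⋆-distribʳ-- (λ k → c (suc k)) c f j) ⟩
    c 0 * f (suc j) + (((λ k → c (suc k)) ⋆ f) j - (c ⋆ f) j)
      ≡⟨ solve 3 (λ x u v → x :+ (u :- v) := (x :+ u) :- v) refl _ _ _ ⟩
    (c ⋆ f) (suc j) - (c ⋆ f) j ∎)

  ⋆-zeroˡ : ∀ c f j → (∀ k → k ≤ j → c k ≡ 0#) → (c ⋆ f) j ≡ 0#
  ⋆-zeroˡ c f zero    c≡0 = trans (cong (_* f 0) (c≡0 0 z≤n)) (zeroˡ _)
  ⋆-zeroˡ c f (suc j) c≡0 = begin
    c 0 * f (suc j) + ((λ k → c (suc k)) ⋆ f) j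
      ≡⟨ cong₂ _+_ (cong (_* f (suc j)) (c≡0 0 z≤n))
                   (⋆-zeroˡ (λ k → c (suc k)) f j (λ k k≤j → c≡0 (suc k) (s≤s k≤j))) ⟩
    0# * f (suc j) + 0#  ≡⟨ +-identityʳ _ ⟩
    0# * f (suc j)       ≡⟨ zeroˡ _ ⟩
    0#                   ∎

  ⋆-identityˡ : ∀ c f j → c 0 ≡ 1# → (∀ k → k < j → c (suc k) ≡ 0#) → (c ⋆ f) j ≡ f j
  ⋆-identityˡ c f zero    c₀≡1 _   = trans (cong (_* f 0) c₀≡1) (*-identityˡ _)
  ⋆-identityˡ c f (suc j) c₀≡1 c≡0 = begin
    c 0 * f (suc j) + ((λ k → c (suc k)) ⋆ f) j
      ≡⟨ cong₂ _+_ (cong (_* f (suc j)) c₀≡1)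
                   (⋆-zeroˡ (λ k → c (suc k)) f j (λ k k≤j → c≡0 k (s≤s k≤j))) ⟩
    1# * f (suc j) + 0#  ≡⟨ +-identityʳ _ ⟩
    1# * f (suc j)       ≡⟨ *-identityˡ _ ⟩
    f (suc j)            ∎

  alternatingBinomial : ℕ → Seq
  alternatingBinomial n k = (- 1#) ^ k * fromℕ (n choose k)

  alternatingBinomial-zero : ∀ n → alternatingBinomial n 0 ≡ 1#
  alternatingBinomial-zero n = trans (*-identityˡ _) (+-identityʳ 1#)

  alternatingBinomial-suc : ∀ n k → alternatingBinomial (suc n) k ≡ Δ (alternatingBinomial n) k
  alternatingBinomial-suc n zero    = refl
  alternatingBinomial-suc n (suc k) = begin
    (- 1#) ^ suc k * fromℕ (n choose k ℕ.+ n choose suc k)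
      ≡⟨ cong₂ _*_ (-1*x≈-x s) (×-homo-+ 1# (n choose k) (n choose suc k)) ⟩
    (- s) * (u + v)
      ≡⟨ solve 3 (λ s u v → (:- s) :* (u :+ v) := (:- s) :* v :- s :* u) refl s u v ⟩
    (- s) * v - s * u
      ≡⟨ cong (λ t → t * v - s * u) (-1*x≈-x s) ⟨
    Δ (alternatingBinomial n) (suc k) ∎
    where
    s = (- 1#) ^ k
    u = fromℕ (n choose k)
    v = fromℕ (n choose suc k)

  Δ^≗alternatingBinomial⋆ : ∀ n f j → Δ^ n f j ≡ (alternatingBinomial n ⋆ f) j
  Δ^≗alternatingBinomial⋆ zero    f j =
    sym (⋆-identityˡ (alternatingBinomial 0) f j (alternatingBinomial-zero 0) (λ k _ → zeroʳ ((- 1#) ^ suc k)))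
  Δ^≗alternatingBinomial⋆ (suc n) f j = begin
    Δ (Δ^ n f) j                             ≡⟨ Δ-cong (Δ^≗alternatingBinomial⋆ n f) j ⟩
    Δ (alternatingBinomial n ⋆ f) j          ≡⟨ Δ-⋆ (alternatingBinomial n) f j ⟩
    (Δ (alternatingBinomial n) ⋆ f) j        ≡⟨ ⋆-congˡ f (alternatingBinomial-suc n) j ⟨
    (alternatingBinomial (suc n) ⋆ f) j      ∎

  module _ {p : ℕ} (p-prime : Prime p) (p≡0 : fromℕ p ≡ 0#) where

    alternatingBinomial-vanishes : ∀ k → suc k < p → alternatingBinomial p (suc k) ≡ 0#
    alternatingBinomial-vanishes k k<p with prime∣choose p-prime k<p
    ... | divides t eq = begin
      s * fromℕ (p choose suc k)   ≡⟨ cong (λ c → s * fromℕ c) eq ⟩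
      s * fromℕ (t ℕ.* p)          ≡⟨ cong (s *_) (×1-homo-* t p) ⟩
      s * (fromℕ t * fromℕ p)      ≡⟨ cong (λ x → s * (fromℕ t * x)) p≡0 ⟩
      s * (fromℕ t * 0#)           ≡⟨ cong (s *_) (zeroʳ (fromℕ t)) ⟩
      s * 0#                       ≡⟨ zeroʳ s ⟩
      0#                           ∎
      where s = (- 1#) ^ suc k

    Δ^p-identity : ∀ f j → j < p → Δ^ p f j ≡ f j
    Δ^p-identity f j j<p = begin
      Δ^ p f j                     ≡⟨ Δ^≗alternatingBinomial⋆ p f j ⟩
      (alternatingBinomial p ⋆ f) j ≡⟨ ⋆-identityˡ (alternatingBinomial p) f j (alternatingBinomial-zero p)
                                         (λ k k<j → alternatingBinomial-vanishes k (ℕ.≤-<-trans k<j j<p)) ⟩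
      f j                          ∎

module FieldProperties (F : Field) where
  open Field F using (_⁻¹; *-inverse; 0≢1; isCommutativeRing)
  open CommutativeRingArithmetic isCommutativeRing public
  open CommutativeRing commutativeRing hiding (refl; sym; trans)
  open RingProperties ring using (-0#≈0#; -‿involutive)
  open SemiringExp semiring using (_^_)
  open ≡-Reasoning

  *-cancel-⁻¹ʳ : ∀ {x} → ¬ x ≡ 0# → ∀ y → x * y * x ⁻¹ ≡ y
  *-cancel-⁻¹ʳ {x} x≢0 y = begin
    x * y * x ⁻¹     ≡⟨ solve 3 (λ x y z → x :* y :* z := x :* z :* y) refl x y (x ⁻¹) ⟩
    x * x ⁻¹ * y     ≡⟨ cong (_* y) (*-inverse x x≢0) ⟩
    1# * y           ≡⟨ *-identityˡ y ⟩
    y                ∎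

  x*y≢0 : ∀ {x y} → ¬ x ≡ 0# → ¬ y ≡ 0# → ¬ x * y ≡ 0#
  x*y≢0 {x} {y} x≢0 y≢0 xy≡0 = y≢0 (begin
    y                ≡⟨ *-cancel-⁻¹ʳ x≢0 y ⟨
    x * y * x ⁻¹     ≡⟨ cong (_* x ⁻¹) xy≡0 ⟩
    0# * x ⁻¹        ≡⟨ zeroˡ _ ⟩
    0#               ∎)

  x^n≢0 : ∀ {x} → ¬ x ≡ 0# → ∀ n → ¬ x ^ n ≡ 0#
  x^n≢0 x≢0 zero    1≡0 = 0≢1 (sym 1≡0)
  x^n≢0 x≢0 (suc n)     = x*y≢0 x≢0 (x^n≢0 x≢0 n)

  -x≢0 : ∀ {x} → ¬ x ≡ 0# → ¬ - x ≡ 0#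
  -x≢0 {x} x≢0 -x≡0 = x≢0 (begin
    x         ≡⟨ -‿involutive x ⟨
    - - x     ≡⟨ cong -_ -x≡0 ⟩
    - 0#      ≡⟨ -0#≈0# ⟩
    0#        ∎)

  ^ᶠ≗^ : ∀ x n → Field._^_ F x n ≡ x ^ n
  ^ᶠ≗^ x zero    = refl
  ^ᶠ≗^ x (suc n) = cong (x *_) (^ᶠ≗^ x n)

module FiniteField (F : Field) {q : ℕ} (card : HasCard F q) where
  open FieldProperties F
  open CommutativeRing commutativeRing hiding (refl; sym; trans)
  open CommutativeMonoidSum +-commutativeMonoid using (sum; sum-permute; ∑-distrib-+; sum-cong-≗; sum-replicate)
  open RingProperties ring using (+-cancelˡ)
  open Inverse card
  open ≡-Reasoning

  _≟_ : DecidableEquality Carrier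
  x ≟ y with from x Fin.≟ from y
  ... | yes x≡y = yes (trans (sym (strictlyInverseˡ x)) (trans (cong to x≡y) (strictlyInverseˡ y)))
  ... | no  x≢y = no λ x≡y → x≢y (cong from x≡y)

  +1-translation : Carrier ↔ Carrier
  +1-translation = mk↔ₛ′ (_+ 1#) (_- 1#)
    (λ y → solve 2 (λ y o → y :- o :+ o := y) refl y 1#)
    (λ x → solve 2 (λ x o → x :+ o :- o := x) refl x 1#)

  fromℕ-q≡0 : fromℕ q ≡ 0#
  fromℕ-q≡0 = sym (+-cancelˡ (sum to) 0# (fromℕ q) (begin
    sum to + 0#                        ≡⟨ +-identityʳ (sum to) ⟩
    sum to                             ≡⟨ sum-permute to (↔-sym card ↔-∘ (+1-translation ↔-∘ card)) ⟩
    sum (λ i → to (from (to i + 1#)))  ≡⟨ sum-cong-≗ (λ i → strictlyInverseˡ (to i + 1#)) ⟩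
    sum (λ i → to i + 1#)              ≡⟨ ∑-distrib-+ to (λ _ → 1#) ⟩
    sum to + sum {q} (λ _ → 1#)        ≡⟨ cong (sum to +_) (sum-replicate q) ⟩
    sum to + fromℕ q                   ∎))

  q≡pᵏ⇒fromℕ-p≡0 : ∀ p k → q ≡ p ℕ.^ k → fromℕ p ≡ 0#
  q≡pᵏ⇒fromℕ-p≡0 p k q≡pᵏ = decidable-stable (fromℕ p ≟ 0#) λ p≢0 →
    x^n≢0 p≢0 k (trans (sym (fromℕ-^ p k)) (trans (cong fromℕ (sym q≡pᵏ)) fromℕ-q≡0))

module DelannoyRows (F : Field) where
  open Field F using (_⁻¹; *-inverse)
  open FieldProperties F
  open DifferenceCalculus (Field.isCommutativeRing F)
  open CommutativeRing commutativeRing using (_+_; _*_; -_; 0#; 1#; _-_; -‿inverseʳ; semiring)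
  open SemiringExp semiring using (_^_)
  open ≡-Reasoning

  Δ-row-zero : ∀ x j → Δ (Fentry F x 0) j ≡ δ j
  Δ-row-zero x zero    = refl
  Δ-row-zero x (suc j) = -‿inverseʳ 1#

  Δ-row-suc : ∀ x i j → Δ (Fentry F x (suc i)) j ≡ Λ x (Fentry F x i) j
  Δ-row-suc x zero    zero    = refl
  Δ-row-suc x (suc i) zero    = refl
  Δ-row-suc x i       (suc j) = solve 3 (λ u v w → u :+ v :+ w :- w := u :+ v) refl _ _ _

  Δ^-row : ∀ x i j → Δ^ (suc i) (Fentry F x i) j ≡ Λ^ x i δ j
  Δ^-row x zero    j = Δ-row-zero x j
  Δ^-row x (suc i) j = begin
    Δ^ (suc (suc i)) (Fentry F x (suc i)) j  ≡⟨ Δ^-suc (suc i) (Fentry F x (suc i)) j ⟩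
    Δ^ (suc i) (Δ (Fentry F x (suc i))) j    ≡⟨ Δ^-cong (suc i) (Δ-row-suc x i) j ⟩
    Δ^ (suc i) (Λ x (Fentry F x i)) j        ≡⟨ Δ^∘Λ (suc i) x (Fentry F x i) j ⟩
    Λ x (Δ^ (suc i) (Fentry F x i)) j        ≡⟨ Λ-cong (Δ^-row x i) j ⟩
    Λ^ x (suc i) δ j                         ∎

  module CharacteristicP {n : ℕ} (p-prime : Prime (suc n)) (p≡0 : fromℕ (suc n) ≡ 0#) where
    open CommutativeRing commutativeRing using (*-identityˡ; *-identityʳ; *-assoc; +-identityʳ; zeroʳ; ring; commutativeSemiring)
    open RingProperties ring using (-1*x≈-x)
    open SemiringExp semiring using (^-homo-*)
    open CommutativeSemiringExp commutativeSemiring using (^-distrib-*)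

    Fentry-lastColumn-signed : ∀ x a i → a ℕ.+ i ≡ n → Fentry F x i n ≡ (- 1#) ^ a * x ^ i
    Fentry-lastColumn-signed x a i refl = begin
      Fentry F x i (a ℕ.+ i)                    ≡⟨ Δ^p-identity p-prime p≡0 (Fentry F x i) (a ℕ.+ i) (ℕ.n<1+n _) ⟨
      Δ^ (suc (a ℕ.+ i)) (Fentry F x i) (a ℕ.+ i) ≡⟨ cong (λ k → Δ^ k (Fentry F x i) (a ℕ.+ i)) (ℕ.+-suc a i) ⟨
      Δ^ (a ℕ.+ suc i) (Fentry F x i) (a ℕ.+ i) ≡⟨ cong (λ g → g (a ℕ.+ i)) (Δ^-+ a (suc i) (Fentry F x i)) ⟩
      Δ^ a (Δ^ (suc i) (Fentry F x i)) (a ℕ.+ i) ≡⟨ Δ^-cong a (Δ^-row x i) (a ℕ.+ i) ⟩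
      Δ^ a (Λ^ x i δ) (a ℕ.+ i)                 ≡⟨ Δ^-top a (Λ^δ-vanishes x i) ⟩
      (- 1#) ^ a * Λ^ x i δ i                   ≡⟨ cong ((- 1#) ^ a *_) (Λ^δ-top x i) ⟩
      (- 1#) ^ a * x ^ i                        ∎

    [-1]^[p-1]≡1 : (- 1#) ^ n ≡ 1#
    [-1]^[p-1]≡1 = sym (trans (Fentry-lastColumn-signed 1# n 0 (ℕ.+-identityʳ n)) (*-identityʳ _))

    Fentry-lastColumn : ∀ x {i} → i ≤ n → Fentry F x i n ≡ (- x) ^ i
    Fentry-lastColumn x {i} i≤n = begin
      Fentry F x i n              ≡⟨ Fentry-lastColumn-signed x a i a+i≡n ⟩
      (- 1#) ^ a * x ^ i          ≡⟨ cong (_* x ^ i) [-1]^a≡[-1]^i ⟩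
      (- 1#) ^ i * x ^ i          ≡⟨ ^-distrib-* (- 1#) x i ⟨
      (- 1# * x) ^ i              ≡⟨ cong (_^ i) (-1*x≈-x x) ⟩
      (- x) ^ i                   ∎
      where
      a = n ℕ.∸ i
      a+i≡n : a ℕ.+ i ≡ n
      a+i≡n = ℕ.m∸n+n≡m i≤n
      [-1]^a≡[-1]^i : (- 1#) ^ a ≡ (- 1#) ^ i
      [-1]^a≡[-1]^i = begin
        (- 1#) ^ a                              ≡⟨ *-identityʳ _ ⟨
        (- 1#) ^ a * 1#                         ≡⟨ cong ((- 1#) ^ a *_) ([-1]^n*[-1]^n≡1 i) ⟨
        (- 1#) ^ a * ((- 1#) ^ i * (- 1#) ^ i)  ≡⟨ *-assoc _ _ _ ⟨
        (- 1#) ^ a * (- 1#) ^ i * (- 1#) ^ i    ≡⟨ cong (_* (- 1#) ^ i) (^-homo-* (- 1#) a i) ⟨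
        (- 1#) ^ (a ℕ.+ i) * (- 1#) ^ i         ≡⟨ cong (λ k → (- 1#) ^ k * (- 1#) ^ i) a+i≡n ⟩
        (- 1#) ^ n * (- 1#) ^ i                 ≡⟨ cong (_* (- 1#) ^ i) [-1]^[p-1]≡1 ⟩
        1# * (- 1#) ^ i                         ≡⟨ *-identityˡ _ ⟩
        (- 1#) ^ i                              ∎

    -x*-y≡x*y : ∀ x y → - x * - y ≡ x * y
    -x*-y≡x*y = solve 2 (λ x y → (:- x) :* (:- y) := x :* y) refl

    Fentry-reflect : ∀ {m m′} → m * m′ ≡ 1# → ∀ i j j′ → j ℕ.+ j′ ≡ n → i ≤ n →
                     Fentry F m i j ≡ (- m) ^ i * Fentry F m′ i j′
    Fentry-reflect mm′≡1 zero    j       j′ j+j′≡n i≤n = sym (*-identityˡ 1#)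
    Fentry-reflect {m} {m′} mm′≡1 (suc i) zero    j′ refl i≤n = sym (begin
      (- m) ^ suc i * Fentry F m′ (suc i) j′  ≡⟨ cong ((- m) ^ suc i *_) (Fentry-lastColumn m′ i≤n) ⟩
      (- m) ^ suc i * (- m′) ^ suc i         ≡⟨ ^-distrib-* (- m) (- m′) (suc i) ⟨
      (- m * - m′) ^ suc i                   ≡⟨ cong (_^ suc i) (trans (-x*-y≡x*y m m′) mm′≡1) ⟩
      1# ^ suc i                             ≡⟨ 1^n≡1 (suc i) ⟩
      1#                                     ∎)
    Fentry-reflect {m} {m′} mm′≡1 (suc i) (suc j) j′ j+j′≡n i<n = begin
      Fentry F m i (suc j) + m * Fentry F m i j + Fentry F m (suc i) j
        ≡⟨ cong₂ (λ u v → u + m * v + Fentry F m (suc i) j) (Fentry-reflect mm′≡1 i (suc j) j′ j+j′≡n i≤n)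
                                                             (Fentry-reflect mm′≡1 i j (suc j′) j+j′≡n′ i≤n) ⟩
      P * b₁ + m * (P * b₂) + Fentry F m (suc i) j
        ≡⟨ cong (P * b₁ + m * (P * b₂) +_) (Fentry-reflect mm′≡1 (suc i) j (suc j′) j+j′≡n′ i<n) ⟩
      P * b₁ + m * (P * b₂) + - m * P * (b₂ + m′ * b₁ + b₃)
        ≡⟨ solve 6 (λ P b₁ b₂ b₃ m m′ → P :* b₁ :+ m :* (P :* b₂) :+ (:- m) :* P :* (b₂ :+ m′ :* b₁ :+ b₃)
                                      := (:- m) :* P :* b₃ :+ (P :* b₁ :- P :* b₁ :* (m :* m′))) refl P b₁ b₂ b₃ m m′ ⟩
      - m * P * b₃ + (P * b₁ - P * b₁ * (m * m′))
        ≡⟨ cong (λ t → - m * P * b₃ + (P * b₁ - P * b₁ * t)) mm′≡1 ⟩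
      - m * P * b₃ + (P * b₁ - P * b₁ * 1#)
        ≡⟨ cong (λ t → - m * P * b₃ + (P * b₁ - t)) (*-identityʳ (P * b₁)) ⟩
      - m * P * b₃ + (P * b₁ - P * b₁)
        ≡⟨ cong (- m * P * b₃ +_) (-‿inverseʳ (P * b₁)) ⟩
      - m * P * b₃ + 0#
        ≡⟨ +-identityʳ _ ⟩
      (- m) ^ suc i * Fentry F m′ (suc i) j′ ∎
      where
      P = (- m) ^ i
      b₁ = Fentry F m′ i j′
      b₂ = Fentry F m′ i (suc j′)
      b₃ = Fentry F m′ (suc i) j′
      i≤n = ℕ.<⇒≤ i<n
      j+j′≡n′ : j ℕ.+ suc j′ ≡ n
      j+j′≡n′ = trans (ℕ.+-suc j j′) j+j′≡n

    scaled-row≡reversed-row : ∀ {m} → ¬ m ≡ 0# → ∀ {i j j′} → j ℕ.+ j′ ≡ n → i ≤ n →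
                              Fentry F m i j * (Field._^_ F (- m) i) ⁻¹ ≡ Fentry F (m ⁻¹) i j′
    scaled-row≡reversed-row {m} m≢0 {i} {j} {j′} j+j′≡n i≤n = begin
      Fentry F m i j * (Field._^_ F (- m) i) ⁻¹          ≡⟨ cong (λ t → Fentry F m i j * t ⁻¹) (^ᶠ≗^ (- m) i) ⟩
      Fentry F m i j * ((- m) ^ i) ⁻¹
        ≡⟨ cong (_* ((- m) ^ i) ⁻¹) (Fentry-reflect (*-inverse m m≢0) i j j′ j+j′≡n i≤n) ⟩
      (- m) ^ i * Fentry F (m ⁻¹) i j′ * ((- m) ^ i) ⁻¹  ≡⟨ *-cancel-⁻¹ʳ (x^n≢0 (-x≢0 m≢0) i) _ ⟩
      Fentry F (m ⁻¹) i j′                               ∎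

-- Imported only here: an unqualified ℕ._^_ would clash with the ring exponentiation above.
open import Data.Nat using (ℕ; _^_; _≥_)

lemma4p4 : (p k : ℕ) → Prime p → k ≥ 1 → (F : Field) → HasCard F (p ^ k)
    → (m : Field.Carrier F) → ¬ (m ≡ Field.0# F)
    → (i j : Fin p) → 𝒪 F p m (Fmat F p m) i j ≡ Σᶜ F p (Fmat F p (Field._⁻¹ F m)) i j
lemma4p4 zero    _ _ _ _ _ _ _ () _
lemma4p4 (suc n) k p-prime _ F card m m≢0 i j =
  scaled-row≡reversed-row m≢0 j+j′≡n (ℕ.≤-pred (Fin.toℕ<n i))
  where
  open DelannoyRows.CharacteristicP F p-prime (FiniteField.q≡pᵏ⇒fromℕ-p≡0 F card (suc n) k refl)
  j′ = Fin.toℕ (Fin.opposite j)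
  j+j′≡n : Fin.toℕ j ℕ.+ j′ ≡ n
  j+j′≡n = trans (cong (Fin.toℕ j ℕ.+_) (Fin.opposite-prop j)) (ℕ.m+[n∸m]≡n (ℕ.≤-pred (Fin.toℕ<n j)))
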